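{- Let $(D,S,T,\ell)$ be a contracted instance of UDTM and let $v\in S\cap T$. If any of the following conditions holds, then $(D,S,T,\ell)$ is a yes-instance if and only if $(D-v,\,S\setminus\{v\},\,T\setminus\{v\},\,\ell)$ is a yes-instance: (1) there is no directed path from any vertex of $S\setminus T$ to $v$; (2) there is no directed path from $v$ to any vertex of $T\setminus S$; (3) every directed path from any vertex of $S\setminus T$ to $v$ contains at least $\ell+1$ obstacles, and every directed path from $v$ to any vertex of $T\setminus S$ contains at least $\ell+1$ obstacles.
   Context: Tokens sit on vertices of a digraph $D$. A configuration is a set of vertices (one token on each). A move is a pair $(s,t)$; executing it moves the token on $s$ to $t$. A vertex is free if it carries no token; a directed path is free if all its intermediate vertices are free. A move $(s,t)$ in a sequence is valid if, after executing the preceding moves, there is a token on $s$, $t$ is free, and there is a free directed path from $s$ to $t$. A transforming sequence from $S$ to $T$ is a sequence of valid moves whose execution from $S$ yields $T$. An instance $(D,S,T,\ell)$ of UDTM ($|S|=|T|$, $\ell$ an integer) is a yes-instance if a transforming sequence from $S$ to $T$ of length at most $\ell$ exists. It is contracted if $V(D)=S\cup T$. The obstacles are the vertices of $S\cap T$. -}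

module Defs where

open import Data.Nat using (ℕ)
open import Data.Integer using (ℤ; +_; _≤_; _+_; 1ℤ)
open import Data.Fin using (Fin)
open import Data.Fin.Subset.Properties using (_∈?_)
open import Data.Fin.Subset using (Subset; _∈_; _∉_; _∩_; _∪_; ⁅_⁆; _-_)
open import Data.List using (List; []; _∷_; length; filter)
open import Data.List.Relation.Unary.All using (All)
open import Data.List.Relation.Unary.Unique.Propositional using (Unique)
open import Data.Product using (Σ; _×_; _,_; ∃)
open import Data.Sum using (_⊎_)
open import Relation.Binary.PropositionalEquality using (_≡_)

record Digraph (n : ℕ) : Set₁ where
  field
    V : Subset n
    E : Fin n → Fin n → Set
open Digraph public

-- D - v : delete vertex v (arcs incident to v become unusable since
-- walks must stay inside the vertex set).
_-ᵥ_ : ∀ {n} → Digraph n → Fin n → Digraph n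
D -ᵥ v = record { V = V D - v ; E = E D }

data Walk {n} (D : Digraph n) : Fin n → Fin n → List (Fin n) → Set where
  stop : ∀ {v} → v ∈ V D → Walk D v v (v ∷ [])
  step : ∀ {u w t p} → u ∈ V D → E D u w → Walk D w t p → Walk D u t (u ∷ p)

Path : ∀ {n} → Digraph n → Fin n → Fin n → List (Fin n) → Set
Path D s t p = Walk D s t p × Unique p

-- A free directed path w.r.t. configuration C: every intermediate vertex
-- (i.e. every vertex other than the endpoints, the path being simple) is free.
FreePath : ∀ {n} → Digraph n → Subset n → Fin n → Fin n → Set
FreePath D C s t =
  Σ (List (Fin _)) λ p → Path D s t p × All (λ x → x ≡ s ⊎ x ≡ t ⊎ x ∉ C) p

execute : ∀ {n} → Subset n → Fin n → Fin n → Subset n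
execute C s t = (C - s) ∪ ⁅ t ⁆

data Transforms {n} (D : Digraph n) : Subset n → Subset n → List (Fin n × Fin n) → Set where
  done : ∀ {C} → Transforms D C C []
  move : ∀ {C C' s t ms} → s ∈ C → t ∉ C → FreePath D C s t →
         Transforms D (execute C s t) C' ms → Transforms D C C' ((s , t) ∷ ms)

YesInstance : ∀ {n} → Digraph n → Subset n → Subset n → ℤ → Set
YesInstance D S T ℓ =
  Σ (List (Fin _ × Fin _)) λ ms → Transforms D S T ms × (+ length ms) ≤ ℓ

obstacles : ∀ {n} → Subset n → Subset n → List (Fin n) → ℕ
obstacles S T p = length (filter (λ x → x ∈? (S ∩ T)) p)

{-# OPTIONS --safe #-}
module Submission where

-- A transforming sequence in D − v stays one in D once the token on v is put back. Conversely, a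
-- transforming sequence of length N ≤ ℓ that never moves the token on v is already one in D − v, and
-- two invariants show that it cannot move it. Forwards: after i moves every free vertex has a walk to
-- T ∖ S meeting at most i obstacles (initially the free vertices are those of T ∖ S, and a vacated
-- vertex has an arc to a vertex that was free before the move). Backwards: with i moves still to come,
-- every free vertex has a walk from S ∖ T meeting at most i obstacles (the vertex a token moves to is
-- entered by an arc from a vertex free after the move). So if the token on v moves, v reaches T ∖ S
-- and is reached from S ∖ T by walks, hence by paths (loop erasure keeps a sublist of the vertices),
-- meeting at most N obstacles; each of the three conditions rules one of these out.

open import Defs
open import Data.Nat as ℕ using (ℕ; suc)
import Data.Nat.Properties as ℕ
open import Data.Integer using (ℤ; +_; _≤_; _+_; 1ℤ)
import Data.Integer.Properties as ℤ
open import Data.Fin using (Fin; _≟_)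
open import Data.Fin.Subset using (Subset; _∈_; _∉_; _⊆_; _∪_; _∩_; ∣_∣; _─_; _-_; ⁅_⁆; inside)
open import Data.Fin.Subset.Properties
  using (x∈p∪q⁻; x∈p∪q⁺; x∈p∩q⁻; x∈⁅x⁆; x∈⁅y⁆⇒x≡y; ⊆-antisym; p─q⊆p; x∈p∧x≢y⇒x∈p-y; _∈?_)
open import Data.Vec using (here; there; _∷_)
open import Data.List using (List; []; _∷_; _++_; [_]; length; filter)
open import Data.List.Properties using (filter-++; length-++; length-filter; filter-reject)
open import Data.List.Relation.Unary.All as All using (All; []; _∷_)
open import Data.List.Relation.Unary.All.Properties using (¬Any⇒All¬)
open import Data.List.Relation.Unary.Any using (any?; here; there)
open import Data.List.Relation.Unary.AllPairs using ([]; _∷_)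
open import Data.List.Membership.Propositional using () renaming (_∈_ to _∈ₗ_)
import Data.List.Relation.Binary.Sublist.Propositional as Sublist
open Sublist using ([]; _∷_; _∷ʳ_)
open import Data.List.Relation.Binary.Sublist.Propositional.Properties using (filter⁺; length-mono-≤)
open import Data.Empty using (⊥-elim)
open import Data.Product using (_×_; _,_; proj₁; proj₂; ∃-syntax)
open import Data.Sum as Sum using (_⊎_; inj₁; inj₂)
open import Function using (_∘_; case_of_)
open import Function.Bundles using (_⇔_; mk⇔)
open import Relation.Nullary using (¬_; yes; no)
open import Relation.Unary using (Decidable)
open import Relation.Binary.PropositionalEquality using (_≡_; _≢_; refl; sym; trans; cong; subst; subst₂)

x∈p─q⇒x∉q : ∀ {n} {x : Fin n} (p q : Subset n) → x ∈ p ─ q → x ∉ q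
x∈p─q⇒x∉q (inside ∷ p) (inside ∷ q) () here
x∈p─q⇒x∉q (_ ∷ p) (_ ∷ q) (there x∈p─q) (there x∈q) = x∈p─q⇒x∉q p q x∈p─q x∈q

module _ {n : ℕ} where

  x∈p-y⇒x∈p : ∀ {x y : Fin n} {p : Subset n} → x ∈ p - y → x ∈ p
  x∈p-y⇒x∈p {y = y} {p} = p─q⊆p p ⁅ y ⁆

  x∈p-y⇒x≢y : ∀ {x y : Fin n} {p : Subset n} → x ∈ p - y → x ≢ y
  x∈p-y⇒x≢y {x} {p = p} x∈p-y refl = x∈p─q⇒x∉q p ⁅ x ⁆ x∈p-y (x∈⁅x⁆ x)

  x∉p∧x≢y⇒x∉p∪⁅y⁆ : ∀ {x y : Fin n} {p : Subset n} → x ∉ p → x ≢ y → x ∉ p ∪ ⁅ y ⁆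
  x∉p∧x≢y⇒x∉p∪⁅y⁆ {y = y} {p} x∉p x≢y x∈ with x∈p∪q⁻ p ⁅ y ⁆ x∈
  ... | inj₁ x∈p = x∉p x∈p
  ... | inj₂ x∈⁅y⁆ = x≢y (x∈⁅y⁆⇒x≡y y x∈⁅y⁆)

  p-x∪⁅x⁆≡p : ∀ {x : Fin n} {p : Subset n} → x ∈ p → (p - x) ∪ ⁅ x ⁆ ≡ p
  p-x∪⁅x⁆≡p {x} {p} x∈p = ⊆-antisym ⊆p p⊆
    where
    ⊆p : (p - x) ∪ ⁅ x ⁆ ⊆ p
    ⊆p y∈ with x∈p∪q⁻ (p - x) ⁅ x ⁆ y∈
    ... | inj₁ y∈p-x = x∈p-y⇒x∈p y∈p-x
    ... | inj₂ y∈⁅x⁆ with refl ← x∈⁅y⁆⇒x≡y x y∈⁅x⁆ = x∈p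
    p⊆ : p ⊆ (p - x) ∪ ⁅ x ⁆
    p⊆ {y} y∈p with y ≟ x
    ... | yes refl = x∈p∪q⁺ (inj₂ (x∈⁅x⁆ x))
    ... | no y≢x = x∈p∪q⁺ (inj₁ (x∈p∧x≢y⇒x∈p-y y∈p y≢x))

  ∈-execute⁻ : ∀ {x s t : Fin n} {C : Subset n} → x ∈ execute C s t → (x ∈ C × x ≢ s) ⊎ x ≡ t
  ∈-execute⁻ {t = t} {C} x∈ with x∈p∪q⁻ (C - _) ⁅ t ⁆ x∈
  ... | inj₁ x∈C-s = inj₁ (x∈p-y⇒x∈p x∈C-s , x∈p-y⇒x≢y x∈C-s)
  ... | inj₂ x∈⁅t⁆ = inj₂ (x∈⁅y⁆⇒x≡y t x∈⁅t⁆)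

  x∈C⇒x∈execute : ∀ {x s t : Fin n} {C : Subset n} → x ∈ C → x ≢ s → x ∈ execute C s t
  x∈C⇒x∈execute x∈C x≢s = x∈p∪q⁺ (inj₁ (x∈p∧x≢y⇒x∈p-y x∈C x≢s))

  t∈execute : ∀ {s t : Fin n} {C : Subset n} → t ∈ execute C s t
  t∈execute {t = t} = x∈p∪q⁺ (inj₂ (x∈⁅x⁆ t))

  x∉C⇒x∉execute : ∀ {x s t : Fin n} {C : Subset n} → x ∉ C → x ≢ t → x ∉ execute C s t
  x∉C⇒x∉execute x∉C x≢t x∈ with ∈-execute⁻ x∈
  ... | inj₁ (x∈C , _) = x∉C x∈C
  ... | inj₂ x≡t = x≢t x≡t

  s∉execute : ∀ {s t : Fin n} {C : Subset n} → s ≢ t → s ∉ execute C s t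
  s∉execute s≢t s∈ with ∈-execute⁻ s∈
  ... | inj₁ (_ , s≢s) = s≢s refl
  ... | inj₂ s≡t = s≢t s≡t

  execute-─ : ∀ {s t v : Fin n} {C : Subset n} → s ≢ v → t ≢ v →
              execute (C - v) s t ≡ execute C s t - v
  execute-─ {s} {t} {v} {C} s≢v t≢v = ⊆-antisym ⊆ʳ ⊆ˡ
    where
    ⊆ʳ : execute (C - v) s t ⊆ execute C s t - v
    ⊆ʳ x∈ with ∈-execute⁻ x∈
    ... | inj₁ (x∈C-v , x≢s) =
          x∈p∧x≢y⇒x∈p-y (x∈C⇒x∈execute (x∈p-y⇒x∈p x∈C-v) x≢s) (x∈p-y⇒x≢y x∈C-v)
    ... | inj₂ refl = x∈p∧x≢y⇒x∈p-y t∈execute t≢v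
    ⊆ˡ : execute C s t - v ⊆ execute (C - v) s t
    ⊆ˡ x∈ with ∈-execute⁻ (x∈p-y⇒x∈p x∈)
    ... | inj₁ (x∈C , x≢s) = x∈C⇒x∈execute (x∈p∧x≢y⇒x∈p-y x∈C (x∈p-y⇒x≢y x∈)) x≢s
    ... | inj₂ refl = t∈execute

  execute-∪ : ∀ {s t v : Fin n} {C : Subset n} → s ≢ v → t ≢ v →
              execute (C ∪ ⁅ v ⁆) s t ≡ execute C s t ∪ ⁅ v ⁆
  execute-∪ {s} {t} {v} {C} s≢v t≢v = ⊆-antisym ⊆ʳ ⊆ˡ
    where
    ⊆ʳ : execute (C ∪ ⁅ v ⁆) s t ⊆ execute C s t ∪ ⁅ v ⁆
    ⊆ʳ x∈ with ∈-execute⁻ x∈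
    ... | inj₂ refl = x∈p∪q⁺ (inj₁ t∈execute)
    ... | inj₁ (x∈C∪v , x≢s) with x∈p∪q⁻ C ⁅ v ⁆ x∈C∪v
    ...   | inj₁ x∈C = x∈p∪q⁺ (inj₁ (x∈C⇒x∈execute x∈C x≢s))
    ...   | inj₂ x∈⁅v⁆ = x∈p∪q⁺ (inj₂ x∈⁅v⁆)
    ⊆ˡ : execute C s t ∪ ⁅ v ⁆ ⊆ execute (C ∪ ⁅ v ⁆) s t
    ⊆ˡ x∈ with x∈p∪q⁻ (execute C s t) ⁅ v ⁆ x∈
    ... | inj₂ x∈⁅v⁆ with refl ← x∈⁅y⁆⇒x≡y v x∈⁅v⁆ =
          x∈C⇒x∈execute (x∈p∪q⁺ (inj₂ x∈⁅v⁆)) (λ v≡s → s≢v (sym v≡s))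
    ... | inj₁ x∈C′ with ∈-execute⁻ x∈C′
    ...   | inj₁ (x∈C , x≢s) = x∈C⇒x∈execute (x∈p∪q⁺ (inj₁ x∈C)) x≢s
    ...   | inj₂ refl = t∈execute

module _ {n : ℕ} {D : Digraph n} where

  walk-source∈V : ∀ {a b p} → Walk D a b p → a ∈ V D
  walk-source∈V (stop a∈V) = a∈V
  walk-source∈V (step a∈V _ _) = a∈V

  walk-target∈V : ∀ {a b p} → Walk D a b p → b ∈ V D
  walk-target∈V (stop b∈V) = b∈V
  walk-target∈V (step _ _ w) = walk-target∈V w

  walk-vertices∈V : ∀ {a b p} → Walk D a b p → All (_∈ V D) p
  walk-vertices∈V (stop a∈V) = a∈V ∷ []
  walk-vertices∈V (step a∈V _ w) = a∈V ∷ walk-vertices∈V w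

  All-walk-source : ∀ {P : Fin n → Set} {a b p} → Walk D a b p → All P p → P a
  All-walk-source (stop _) (Pa ∷ _) = Pa
  All-walk-source (step _ _ _) (Pa ∷ _) = Pa

  walk-∷ʳ : ∀ {a b c p} → Walk D a b p → E D b c → c ∈ V D → Walk D a c (p ++ [ c ])
  walk-∷ʳ (stop b∈V) e c∈V = step b∈V e (stop c∈V)
  walk-∷ʳ (step a∈V e′ w) e c∈V = step a∈V e′ (walk-∷ʳ w e c∈V)

  first-arc-out : ∀ {P : Fin n → Set} {s t p} → Walk D s t p → s ≢ t →
                  All (λ x → x ≡ s ⊎ P x) p → ∃[ w ] E D s w × w ∈ V D × P w
  first-arc-out (stop _) s≢t _ = ⊥-elim (s≢t refl)
  first-arc-out (step {w = w} _ e W) s≢t (_ ∷ A) with All-walk-source W A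
  ... | inj₁ refl = first-arc-out W s≢t A
  ... | inj₂ Pw = w , e , walk-source∈V W , Pw

  last-arc-in : ∀ {P : Fin n → Set} {s t p} → Walk D s t p → s ≢ t →
                All (λ x → x ≡ t ⊎ P x) p → ∃[ y ] E D y t × y ∈ V D × P y
  last-arc-in (stop _) s≢t _ = ⊥-elim (s≢t refl)
  last-arc-in {t = t} (step {w = w} s∈V e W) s≢t (s≡t⊎Ps ∷ A) with w ≟ t
  ... | no w≢t = last-arc-in W w≢t A
  ... | yes refl with s≡t⊎Ps
  ...   | inj₁ s≡t = ⊥-elim (s≢t s≡t)
  ...   | inj₂ Ps = _ , e , s∈V , Ps

  freePath-before-move : ∀ {C s t} → t ∉ C → FreePath D C s t →
                         ∃[ p ] Walk D s t p × All (λ x → x ≡ s ⊎ x ∉ C) p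
  freePath-before-move {C} {s} {t} t∉C (p , (W , _) , A) = p , W , All.map source-or-free A
    where
    source-or-free : ∀ {x} → x ≡ s ⊎ x ≡ t ⊎ x ∉ C → x ≡ s ⊎ x ∉ C
    source-or-free (inj₁ x≡s) = inj₁ x≡s
    source-or-free (inj₂ (inj₁ refl)) = inj₂ t∉C
    source-or-free (inj₂ (inj₂ x∉C)) = inj₂ x∉C

  freePath-after-move : ∀ {C s t} → s ∈ C → t ∉ C → FreePath D C s t →
                        ∃[ p ] Walk D s t p × All (λ x → x ≡ t ⊎ x ∉ execute C s t) p
  freePath-after-move {C} {s} {t} s∈C t∉C (p , (W , _) , A) = p , W , All.map target-or-free A
    where
    target-or-free : ∀ {x} → x ≡ s ⊎ x ≡ t ⊎ x ∉ C → x ≡ t ⊎ x ∉ execute C s t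
    target-or-free (inj₁ refl) = inj₂ (s∉execute λ { refl → t∉C s∈C })
    target-or-free (inj₂ (inj₁ x≡t)) = inj₁ x≡t
    target-or-free {x} (inj₂ (inj₂ x∉C)) with x ≟ t
    ... | yes x≡t = inj₁ x≡t
    ... | no x≢t = inj₂ (x∉C⇒x∉execute x∉C x≢t)

  suffix-path : ∀ {a b q u} → Path D a b q → u ∈ₗ q → ∃[ q′ ] Path D u b q′ × q′ Sublist.⊆ q
  suffix-path P@(stop _ , _) (here refl) = _ , P , Sublist.⊆-refl
  suffix-path P@(step _ _ _ , _) (here refl) = _ , P , Sublist.⊆-refl
  suffix-path (stop _ , _) (there ())
  suffix-path (step _ _ W , _ ∷ U) (there u∈q) with suffix-path (W , U) u∈q
  ... | q′ , P , q′⊆q = q′ , P , _ ∷ʳ q′⊆q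

  walk⇒path : ∀ {a b p} → Walk D a b p → ∃[ q ] Path D a b q × q Sublist.⊆ p
  walk⇒path (stop a∈V) = _ , (stop a∈V , [] ∷ []) , Sublist.⊆-refl
  walk⇒path (step {u = u} u∈V e W) with walk⇒path W
  ... | q , (W′ , U′) , q⊆p with any? (u ≟_) q
  ...   | yes u∈q = let q′ , P , q′⊆q = suffix-path (W′ , U′) u∈q
                    in q′ , P , u ∷ʳ Sublist.⊆-trans q′⊆q q⊆p
  ...   | no u∉q = u ∷ q , (step u∈V e W′ , ¬Any⇒All¬ q u∉q ∷ U′) , refl ∷ q⊆p

module _ {n : ℕ} (S T : Subset n) where
  open ℕ.≤-Reasoning

  private
    obstacle? : Decidable (_∈ S ∩ T)
    obstacle? x = x ∈? S ∩ T

  obstacles-++ : ∀ p q → obstacles S T (p ++ q) ≡ obstacles S T p ℕ.+ obstacles S T q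
  obstacles-++ p q = trans (cong length (filter-++ obstacle? p q)) (length-++ (filter obstacle? p))

  obstacles-[x]≤1 : ∀ x → obstacles S T [ x ] ℕ.≤ 1
  obstacles-[x]≤1 x = length-filter obstacle? [ x ]

  obstacles-[x]≡0 : ∀ {x} → x ∉ S ∩ T → obstacles S T [ x ] ≡ 0
  obstacles-[x]≡0 x∉S∩T = cong length (filter-reject obstacle? x∉S∩T)

  obstacles-∷ : ∀ x p → obstacles S T (x ∷ p) ℕ.≤ suc (obstacles S T p)
  obstacles-∷ x p = begin
    obstacles S T (x ∷ p)                    ≡⟨ obstacles-++ [ x ] p ⟩
    obstacles S T [ x ] ℕ.+ obstacles S T p  ≤⟨ ℕ.+-monoˡ-≤ _ (obstacles-[x]≤1 x) ⟩
    suc (obstacles S T p)                    ∎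

  obstacles-∷ʳ : ∀ p x → obstacles S T (p ++ [ x ]) ℕ.≤ suc (obstacles S T p)
  obstacles-∷ʳ p x = begin
    obstacles S T (p ++ [ x ])               ≡⟨ obstacles-++ p [ x ] ⟩
    obstacles S T p ℕ.+ obstacles S T [ x ]  ≤⟨ ℕ.+-monoʳ-≤ _ (obstacles-[x]≤1 x) ⟩
    obstacles S T p ℕ.+ 1                    ≡⟨ ℕ.+-comm _ 1 ⟩
    suc (obstacles S T p)                    ∎

  obstacles-mono : ∀ {p q} → p Sublist.⊆ q → obstacles S T p ℕ.≤ obstacles S T q
  obstacles-mono p⊆q = length-mono-≤ (filter⁺ obstacle? obstacle? (λ { refl x∈ → x∈ }) p⊆q)

module _ {n : ℕ} {D : Digraph n} {v : Fin n} where

  walk-lift : ∀ {a b p} → Walk (D -ᵥ v) a b p → Walk D a b p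
  walk-lift (stop a∈V) = stop (x∈p-y⇒x∈p a∈V)
  walk-lift (step a∈V e W) = step (x∈p-y⇒x∈p a∈V) e (walk-lift W)

  walk-avoids : ∀ {a b p} → Walk (D -ᵥ v) a b p → All (_≢ v) p
  walk-avoids W = All.map x∈p-y⇒x≢y (walk-vertices∈V W)

  walk-restrict : ∀ {a b p} → Walk D a b p → All (_≢ v) p → Walk (D -ᵥ v) a b p
  walk-restrict (stop a∈V) (a≢v ∷ _) = stop (x∈p∧x≢y⇒x∈p-y a∈V a≢v)
  walk-restrict (step a∈V e W) (a≢v ∷ A) = step (x∈p∧x≢y⇒x∈p-y a∈V a≢v) e (walk-restrict W A)

  freePath-lift : ∀ {C s t} → FreePath (D -ᵥ v) C s t → FreePath D (C ∪ ⁅ v ⁆) s t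
  freePath-lift {C} {s} {t} (p , (W , U) , A) =
    p , (walk-lift W , U) , All.zipWith still-free (A , walk-avoids W)
    where
    still-free : ∀ {x} → (x ≡ s ⊎ x ≡ t ⊎ x ∉ C) × x ≢ v → x ≡ s ⊎ x ≡ t ⊎ x ∉ C ∪ ⁅ v ⁆
    still-free (free , x≢v) = Sum.map₂ (Sum.map₂ (λ x∉C → x∉p∧x≢y⇒x∉p∪⁅y⁆ x∉C x≢v)) free

  freePath-restrict : ∀ {C s t} → v ∈ C → s ≢ v → t ∉ C → FreePath D C s t → FreePath (D -ᵥ v) (C - v) s t
  freePath-restrict {C} {s} {t} v∈C s≢v t∉C (p , (W , U) , A) =
    p , (walk-restrict W (All.map avoids-v A) , U) , All.map (Sum.map₂ (Sum.map₂ (_∘ x∈p-y⇒x∈p))) A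
    where
    avoids-v : ∀ {x} → x ≡ s ⊎ x ≡ t ⊎ x ∉ C → x ≢ v
    avoids-v (inj₁ refl) = s≢v
    avoids-v (inj₂ (inj₁ refl)) refl = t∉C v∈C
    avoids-v (inj₂ (inj₂ x∉C)) refl = x∉C v∈C

  transforms-lift : ∀ {C C′ ms} → Transforms (D -ᵥ v) C C′ ms → Transforms D (C ∪ ⁅ v ⁆) (C′ ∪ ⁅ v ⁆) ms
  transforms-lift done = done
  transforms-lift {C} (move {s = s} {t} s∈C t∉C fp@(_ , (W , _) , _) rest) =
    move (x∈p∪q⁺ (inj₁ s∈C)) (x∉p∧x≢y⇒x∉p∪⁅y⁆ t∉C t≢v) (freePath-lift fp)
      (subst (λ X → Transforms D X _ _) (sym (execute-∪ s≢v t≢v)) (transforms-lift rest))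
    where
    s≢v : s ≢ v
    s≢v = x∈p-y⇒x≢y (walk-source∈V W)
    t≢v : t ≢ v
    t≢v = x∈p-y⇒x≢y (walk-target∈V W)

  transforms-restrict : ∀ {C C′ ms} → v ∈ C → All (λ m → proj₁ m ≢ v) ms →
                        Transforms D C C′ ms → Transforms (D -ᵥ v) (C - v) (C′ - v) ms
  transforms-restrict v∈C [] done = done
  transforms-restrict v∈C (s≢v ∷ s≢vs) (move s∈C t∉C fp rest) =
    move (x∈p∧x≢y⇒x∈p-y s∈C s≢v) (t∉C ∘ x∈p-y⇒x∈p) (freePath-restrict v∈C s≢v t∉C fp)
      (subst (λ X → Transforms (D -ᵥ v) X _ _) (sym (execute-─ s≢v t≢v))
        (transforms-restrict (x∈C⇒x∈execute v∈C (s≢v ∘ sym)) s≢vs rest))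
    where
    t≢v : _ ≢ v
    t≢v refl = t∉C v∈C

module Reachability {n : ℕ} (D : Digraph n) (S T : Subset n) where

  record ReachesTarget (x : Fin n) (k : ℕ) : Set where
    constructor reaches
    field
      {target} : Fin n
      {vertices} : List (Fin n)
      target∈T : target ∈ T
      target∉S : target ∉ S
      walk : Walk D x target vertices
      bounded : obstacles S T vertices ℕ.≤ k

  record ReachedFromSource (x : Fin n) (k : ℕ) : Set where
    constructor reached
    field
      {source} : Fin n
      {vertices} : List (Fin n)
      source∈S : source ∈ S
      source∉T : source ∉ T
      walk : Walk D source x vertices
      bounded : obstacles S T vertices ℕ.≤ k

  FreeReachTarget : Subset n → ℕ → Set
  FreeReachTarget C k = ∀ x → x ∈ V D → x ∉ C → ReachesTarget x k

  FreeReachedFromSource : Subset n → ℕ → Set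
  FreeReachedFromSource C k = ∀ x → x ∈ V D → x ∉ C → ReachedFromSource x k

  reachesTarget-weaken : ∀ {x k k′} → k ℕ.≤ k′ → ReachesTarget x k → ReachesTarget x k′
  reachesTarget-weaken k≤k′ (reaches t∈T t∉S W bounded) = reaches t∈T t∉S W (ℕ.≤-trans bounded k≤k′)

  reachedFromSource-weaken : ∀ {x k k′} → k ℕ.≤ k′ → ReachedFromSource x k → ReachedFromSource x k′
  reachedFromSource-weaken k≤k′ (reached s∈S s∉T W bounded) = reached s∈S s∉T W (ℕ.≤-trans bounded k≤k′)

  ¬reachesTarget : ∀ {x k} → (∀ t p → t ∈ T → t ∉ S → Path D x t p → k ℕ.< obstacles S T p) →
                   ¬ ReachesTarget x k
  ¬reachesTarget many (reaches t∈T t∉S W bounded) with walk⇒path W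
  ... | q , P , q⊆p = ℕ.<⇒≱ (many _ q t∈T t∉S P) (ℕ.≤-trans (obstacles-mono S T q⊆p) bounded)

  ¬reachedFromSource : ∀ {x k} → (∀ s p → s ∈ S → s ∉ T → Path D s x p → k ℕ.< obstacles S T p) →
                       ¬ ReachedFromSource x k
  ¬reachedFromSource many (reached s∈S s∉T W bounded) with walk⇒path W
  ... | q , P , q⊆p = ℕ.<⇒≱ (many _ q s∈S s∉T P) (ℕ.≤-trans (obstacles-mono S T q⊆p) bounded)

  source-reaches-target : ∀ {C s t k} → FreeReachTarget C k → s ∈ C → t ∉ C → FreePath D C s t →
                          ReachesTarget s (suc k)
  source-reaches-target {s = s} free s∈C t∉C fp with freePath-before-move t∉C fp
  ... | _ , W , A with first-arc-out W (λ { refl → t∉C s∈C }) A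
  ... | w , e , w∈V , w∉C with free w w∈V w∉C
  ... | reaches {vertices = q} t∈T t∉S W′ bounded =
        reaches t∈T t∉S (step (walk-source∈V W) e W′) (ℕ.≤-trans (obstacles-∷ S T s q) (ℕ.s≤s bounded))

  free-reach-target-execute : ∀ {C s t k} → FreeReachTarget C k → s ∈ C → t ∉ C → FreePath D C s t →
                              FreeReachTarget (execute C s t) (suc k)
  free-reach-target-execute {s = s} free s∈C t∉C fp x x∈V x∉C′ with x ≟ s
  ... | yes refl = source-reaches-target free s∈C t∉C fp
  ... | no x≢s = reachesTarget-weaken (ℕ.n≤1+n _) (free x x∈V (x∉C′ ∘ (λ x∈C → x∈C⇒x∈execute x∈C x≢s)))

  target-reached-from-source : ∀ {C s t k} → FreeReachedFromSource (execute C s t) k →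
                               s ∈ C → t ∉ C → FreePath D C s t → ReachedFromSource t (suc k)
  target-reached-from-source {t = t} free s∈C t∉C fp with freePath-after-move s∈C t∉C fp
  ... | _ , W , A with last-arc-in W (λ { refl → t∉C s∈C }) A
  ... | y , e , y∈V , y∉C′ with free y y∈V y∉C′
  ... | reached {vertices = q} s∈S s∉T W′ bounded =
        reached s∈S s∉T (walk-∷ʳ W′ e (walk-target∈V W)) (ℕ.≤-trans (obstacles-∷ʳ S T q t) (ℕ.s≤s bounded))

  free-reached-from-source-before : ∀ {C s t k} → FreeReachedFromSource (execute C s t) k →
                                    s ∈ C → t ∉ C → FreePath D C s t → FreeReachedFromSource C (suc k)
  free-reached-from-source-before {t = t} free s∈C t∉C fp x x∈V x∉C with x ≟ t
  ... | yes refl = target-reached-from-source free s∈C t∉C fp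
  ... | no x≢t = reachedFromSource-weaken (ℕ.n≤1+n _) (free x x∈V (x∉C⇒x∉execute x∉C x≢t))

  moved-tokens-reach-target-from : ∀ {C C′ ms k N} → FreeReachTarget C k → k ℕ.+ length ms ℕ.≤ N →
                                   Transforms D C C′ ms → All (λ m → ReachesTarget (proj₁ m) N) ms
  moved-tokens-reach-target-from free _ done = []
  moved-tokens-reach-target-from {k = k} {N} free k+|ms|≤N (move {ms = ms} s∈C t∉C fp rest) =
    reachesTarget-weaken (ℕ.≤-trans (ℕ.m≤m+n (suc k) _) 1+k+|ms|≤N) (source-reaches-target free s∈C t∉C fp)
    ∷ moved-tokens-reach-target-from (free-reach-target-execute free s∈C t∉C fp) 1+k+|ms|≤N rest
    where
    1+k+|ms|≤N : suc k ℕ.+ length ms ℕ.≤ N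
    1+k+|ms|≤N = subst (ℕ._≤ N) (ℕ.+-suc k (length ms)) k+|ms|≤N

  module _ (V≡S∪T : V D ≡ S ∪ T) where

    initially-free-reach-target : FreeReachTarget S 0
    initially-free-reach-target x x∈V x∉S with x∈p∪q⁻ S T (subst (x ∈_) V≡S∪T x∈V)
    ... | inj₁ x∈S = ⊥-elim (x∉S x∈S)
    ... | inj₂ x∈T = reaches x∈T x∉S (stop x∈V)
                       (ℕ.≤-reflexive (obstacles-[x]≡0 S T (x∉S ∘ proj₁ ∘ x∈p∩q⁻ S T)))

    finally-free-reached-from-source : FreeReachedFromSource T 0
    finally-free-reached-from-source x x∈V x∉T with x∈p∪q⁻ S T (subst (x ∈_) V≡S∪T x∈V)
    ... | inj₂ x∈T = ⊥-elim (x∉T x∈T)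
    ... | inj₁ x∈S = reached x∈S x∉T (stop x∈V)
                       (ℕ.≤-reflexive (obstacles-[x]≡0 S T (x∉T ∘ proj₂ ∘ x∈p∩q⁻ S T)))

    moved-tokens-reach-target : ∀ {C ms} → Transforms D S C ms →
                                All (λ m → ReachesTarget (proj₁ m) (length ms)) ms
    moved-tokens-reach-target = moved-tokens-reach-target-from initially-free-reach-target ℕ.≤-refl

    free-reached-from-source : ∀ {C ms} → Transforms D C T ms → FreeReachedFromSource C (length ms)
    free-reached-from-source done = finally-free-reached-from-source
    free-reached-from-source (move s∈C t∉C fp rest) =
      free-reached-from-source-before (free-reached-from-source rest) s∈C t∉C fp

    moved-tokens-reached-from-source : ∀ {C ms} → Transforms D C T ms →
                                       All (λ m → ReachedFromSource (proj₁ m) (length ms)) ms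
    moved-tokens-reached-from-source done = []
    moved-tokens-reached-from-source (move s∈C t∉C (_ , (W , _) , _) rest) =
      reachedFromSource-weaken (ℕ.n≤1+n _)
        (free-reached-from-source rest _ (walk-source∈V W) (s∉execute λ { refl → t∉C s∈C }))
      ∷ All.map (reachedFromSource-weaken (ℕ.n≤1+n _)) (moved-tokens-reached-from-source rest)

sources-≢ : ∀ {n} {P : Fin n → Set} {v : Fin n} {ms : List (Fin n × Fin n)} →
            ¬ P v → All (P ∘ proj₁) ms → All (λ m → proj₁ m ≢ v) ms
sources-≢ {P = P} ¬Pv = All.map (λ Ps s≡v → ¬Pv (subst P s≡v Ps))

+m≤i∧i+1≤+n⇒m<n : ∀ {m n i} → + m ≤ i → i + 1ℤ ≤ + n → m ℕ.< n
+m≤i∧i+1≤+n⇒m<n {i = i} m≤i i+1≤n =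
  ℤ.drop‿+<+ (ℤ.≤-<-trans m≤i (ℤ.suc[i]≤j⇒i<j (subst (_≤ _) (ℤ.+-comm i 1ℤ) i+1≤n)))

lemma5 : ∀ {n} (D : Digraph n) (S T : Subset n) (ℓ : ℤ) (v : Fin n) →
    S ⊆ V D → T ⊆ V D → ∣ S ∣ ≡ ∣ T ∣ →
    V D ≡ S ∪ T →
    v ∈ S → v ∈ T →
    ( (∀ s p → s ∈ S → s ∉ T → ¬ Path D s v p)
    ⊎ (∀ t p → t ∈ T → t ∉ S → ¬ Path D v t p)
    ⊎ ( (∀ s p → s ∈ S → s ∉ T → Path D s v p → ℓ + 1ℤ ≤ + obstacles S T p)
      × (∀ t p → t ∈ T → t ∉ S → Path D v t p → ℓ + 1ℤ ≤ + obstacles S T p))) →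
    YesInstance D S T ℓ ⇔ YesInstance (D -ᵥ v) (S - v) (T - v) ℓ
lemma5 D S T ℓ v _ _ _ V≡S∪T v∈S v∈T condition = mk⇔ restrict lift
  where
  open Reachability D S T

  lift : YesInstance (D -ᵥ v) (S - v) (T - v) ℓ → YesInstance D S T ℓ
  lift (ms , seq , |ms|≤ℓ) =
    ms , subst₂ (λ C C′ → Transforms D C C′ ms) (p-x∪⁅x⁆≡p v∈S) (p-x∪⁅x⁆≡p v∈T) (transforms-lift seq)
       , |ms|≤ℓ

  restrict : YesInstance D S T ℓ → YesInstance (D -ᵥ v) (S - v) (T - v) ℓ
  restrict (ms , seq , |ms|≤ℓ) = ms , transforms-restrict v∈S v-never-moves seq , |ms|≤ℓ
    where
    v-never-moves : All (λ m → proj₁ m ≢ v) ms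
    v-never-moves = case condition of λ where
      (inj₁ no-path-in) →
        sources-≢ (¬reachedFromSource λ s p s∈S s∉T → ⊥-elim ∘ no-path-in s p s∈S s∉T)
          (moved-tokens-reached-from-source V≡S∪T seq)
      (inj₂ (inj₁ no-path-out)) →
        sources-≢ (¬reachesTarget λ t p t∈T t∉S → ⊥-elim ∘ no-path-out t p t∈T t∉S)
          (moved-tokens-reach-target V≡S∪T seq)
      -- The second half of (3) already suffices.
      (inj₂ (inj₂ (_ , many-out))) →
        sources-≢ (¬reachesTarget λ t p t∈T t∉S → +m≤i∧i+1≤+n⇒m<n |ms|≤ℓ ∘ many-out t p t∈T t∉S)
          (moved-tokens-reach-target V≡S∪T seq)
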